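{- Let $G$ be an abelian group and let $\mathrm{pAut}\,G$ be the set of all partial automorphisms $\varphi$ of $G$ such that $G/\mathrm{Dom}\,\varphi$ and $G/\mathrm{Im}\,\varphi$ are both $\aleph_1$-free abelian groups. Then $\mathrm{pAut}\,G$ is a submonoid of the monoid of all partial automorphisms of $G$ (under composition), it contains $1=\mathrm{id}_G$ and $-1=-\mathrm{id}_G$, and it is closed under taking weak inverses: if $\varphi\in\mathrm{pAut}\,G$ then $\varphi^{ -1}\in\mathrm{pAut}\,G$.
   Context: A partial automorphism of $G$ is an isomorphism $\varphi:\mathrm{Dom}\,\varphi\to\mathrm{Im}\,\varphi$ between subgroups of $G$; maps act on the right. Its weak inverse $\varphi^{ -1}$ is the inverse isomorphism $\mathrm{Im}\,\varphi\to\mathrm{Dom}\,\varphi$. The composition $\varphi\psi$ (first $\varphi$, then $\psi$) is the partial automorphism with $\mathrm{Dom}(\varphi\psi)=(\mathrm{Im}\,\varphi\cap\mathrm{Dom}\,\psi)\varphi^{ -1}$, $\mathrm{Im}(\varphi\psi)=(\mathrm{Im}\,\varphi\cap\mathrm{Dom}\,\psi)\psi$, and $x(\varphi\psi)=(x\varphi)\psi$. An abelian group is $\aleph_1$-free if every countable subgroup is free. -}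

module Defs where

open import Level using (Level; _⊔_; Lift; lift) renaming (suc to lsuc)
open import Data.Nat using (ℕ; zero; suc)
open import Data.Integer using (ℤ; +_; -[1+_]; 0ℤ)
open import Data.Fin using (Fin; zero; suc)
open import Data.Product using (Σ; Σ-syntax; ∃; ∃-syntax; _×_; _,_; proj₁; proj₂)
open import Data.Unit.Polymorphic using (⊤; tt)
open import Relation.Binary.PropositionalEquality using (_≡_)
open import Algebra.Bundles using (AbelianGroup)
import Algebra.Properties.Group as GroupProps
import Algebra.Properties.AbelianGroup as AbProps
import Algebra.Properties.CommutativeSemigroup as CSProps
import Relation.Binary.Reasoning.Setoid as SetoidReasoning

module GroupNotions {a b : Level} (A : AbelianGroup a b) where
  open AbelianGroup A

  record Subgroup (q : Level) : Set (a ⊔ b ⊔ lsuc q) where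
    field
      _∈    : Carrier → Set q
      resp   : ∀ {x y} → x ≈ y → x ∈ → y ∈
      ε∈     : ε ∈
      ∙∈     : ∀ {x y} → x ∈ → y ∈ → (x ∙ y) ∈
      ⁻¹∈    : ∀ {x} → x ∈ → (x ⁻¹) ∈

  _×ℕ_ : ℕ → Carrier → Carrier
  zero  ×ℕ x = ε
  suc n ×ℕ x = x ∙ (n ×ℕ x)

  _·_ : ℤ → Carrier → Carrier
  (+ n)      · x = n ×ℕ x
  (-[1+ n ]) · x = (suc n ×ℕ x) ⁻¹

  ∑ : (n : ℕ) → (Fin n → Carrier) → Carrier
  ∑ zero    f = ε
  ∑ (suc n) f = f zero ∙ ∑ n (λ k → f (suc k))

  -- A subgroup S is countable: some sequence ℕ → S hits every element of S
  -- (up to the equality of A).  (Subgroups are nonempty.)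
  Countable : ∀ {q} → Subgroup q → Set (a ⊔ b ⊔ q)
  Countable S = Σ[ e ∈ (ℕ → Carrier) ]
                  ((∀ n → e n ∈ₛ) × (∀ x → x ∈ₛ → ∃[ n ] (x ≈ e n)))
    where open Subgroup S renaming (_∈ to _∈ₛ)

  InjectiveFin : ∀ {n} {I : Set a} → (Fin n → I) → Set a
  InjectiveFin idx = ∀ i j → idx i ≡ idx j → i ≡ j

  Free : ∀ {q} → Subgroup q → Set (lsuc a ⊔ b ⊔ q)
  Free S = Σ[ I ∈ Set a ] Σ[ B ∈ (I → Carrier) ]
             ( (∀ i → B i ∈ₛ)
             × (∀ x → x ∈ₛ → Σ[ n ∈ ℕ ] Σ[ idx ∈ (Fin n → I) ] Σ[ coef ∈ (Fin n → ℤ) ]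
                   (x ≈ ∑ n (λ k → coef k · B (idx k))))
             × (∀ n (idx : Fin n → I) (coef : Fin n → ℤ) → InjectiveFin idx →
                   ∑ n (λ k → coef k · B (idx k)) ≈ ε → ∀ k → coef k ≡ 0ℤ) )
    where open Subgroup S renaming (_∈ to _∈ₛ)

  -- ℵ₁-free: every countable subgroup is free.  (Subgroups are taken with
  -- membership predicates at the level b of the equality of A; every
  -- countable subgroup, being the image of a sequence, is of this form.)
  ℵ₁-Free : Set (lsuc a ⊔ lsuc b)
  ℵ₁-Free = (S : Subgroup b) → Countable S → Free S

-- The quotient group G / H  (same carrier, x ~ y  iff  x ∙ y⁻¹ ∈ H)

module _ {c ℓ : Level} (G : AbelianGroup c ℓ) where
  open AbelianGroup G
  open GroupNotions G
  open AbProps G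
  open CSProps commutativeSemigroup using (interchange)
  open SetoidReasoning setoid

  _/_ : ∀ {p} → Subgroup p → AbelianGroup c p
  _/_ {p} H = record
    { Carrier = Carrier
    ; _≈_ = _~_
    ; _∙_ = _∙_
    ; ε = ε
    ; _⁻¹ = _⁻¹
    ; isAbelianGroup = record
      { isGroup = record
        { isMonoid = record
          { isSemigroup = record
            { isMagma = record
              { isEquivalence = record { refl = ~-refl ; sym = ~-sym ; trans = ~-trans }
              ; ∙-cong = ~-∙
              }
            ; assoc = λ x y z → ≈⇒~ (assoc x y z)
            }
          ; identity = (λ x → ≈⇒~ (identityˡ x)) , (λ x → ≈⇒~ (identityʳ x))
          }
        ; inverse = (λ x → ≈⇒~ (inverseˡ x)) , (λ x → ≈⇒~ (inverseʳ x))
        ; ⁻¹-cong = ~-⁻¹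
        }
      ; comm = λ x y → ≈⇒~ (comm x y)
      }
    }
    where
    open Subgroup H
    _~_ : Carrier → Carrier → Set p
    x ~ y = (x ∙ y ⁻¹) ∈
    ≈⇒~ : ∀ {x y} → x ≈ y → x ~ y
    ≈⇒~ x≈y = resp (sym (x≈y⇒x∙y⁻¹≈ε x≈y)) ε∈
    ~-refl : ∀ {x} → x ~ x
    ~-refl = ≈⇒~ refl
    ~-sym : ∀ {x y} → x ~ y → y ~ x
    ~-sym {x} {y} h = resp (⁻¹-anti-homo‿- x y) (⁻¹∈ h)
    ~-trans : ∀ {x y z} → x ~ y → y ~ z → x ~ z
    ~-trans {x} {y} {z} h k = resp eq (∙∈ h k)
      where
      eq : (x ∙ y ⁻¹) ∙ (y ∙ z ⁻¹) ≈ x ∙ z ⁻¹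
      eq = begin
        (x ∙ y ⁻¹) ∙ (y ∙ z ⁻¹) ≈⟨ assoc x (y ⁻¹) (y ∙ z ⁻¹) ⟩
        x ∙ (y ⁻¹ ∙ (y ∙ z ⁻¹)) ≈⟨ ∙-congˡ (sym (assoc (y ⁻¹) y (z ⁻¹))) ⟩
        x ∙ ((y ⁻¹ ∙ y) ∙ z ⁻¹) ≈⟨ ∙-congˡ (∙-congʳ (inverseˡ y)) ⟩
        x ∙ (ε ∙ z ⁻¹)          ≈⟨ ∙-congˡ (identityˡ (z ⁻¹)) ⟩
        x ∙ z ⁻¹ ∎
    ~-∙ : ∀ {x x' y y'} → x ~ x' → y ~ y' → (x ∙ y) ~ (x' ∙ y')
    ~-∙ {x} {x'} {y} {y'} h k = resp eq (∙∈ h k)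
      where
      eq : (x ∙ x' ⁻¹) ∙ (y ∙ y' ⁻¹) ≈ (x ∙ y) ∙ (x' ∙ y') ⁻¹
      eq = begin
        (x ∙ x' ⁻¹) ∙ (y ∙ y' ⁻¹) ≈⟨ interchange x (x' ⁻¹) y (y' ⁻¹) ⟩
        (x ∙ y) ∙ (x' ⁻¹ ∙ y' ⁻¹) ≈⟨ ∙-congˡ (⁻¹-∙-comm x' y') ⟩
        (x ∙ y) ∙ (x' ∙ y') ⁻¹ ∎
    ~-⁻¹ : ∀ {x y} → x ~ y → (x ⁻¹) ~ (y ⁻¹)
    ~-⁻¹ {x} {y} h = resp eq (⁻¹∈ h)
      where
      eq : (x ∙ y ⁻¹) ⁻¹ ≈ x ⁻¹ ∙ (y ⁻¹) ⁻¹
      eq = sym (⁻¹-∙-comm x (y ⁻¹))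

-- An isomorphism Dom → Im is recorded by total functions fun, inv on the
-- carrier whose behaviour outside Dom resp. Im is irrelevant.

module PartialAutomorphisms {c ℓ : Level} (G : AbelianGroup c ℓ) (p : Level) where
  open AbelianGroup G
  open GroupNotions G
  open AbProps G
  open SetoidReasoning setoid

  record PartialAut : Set (c ⊔ ℓ ⊔ lsuc p) where
    field
      Dom Im  : Subgroup p
      fun inv : Carrier → Carrier
    open Subgroup Dom renaming (_∈ to _∈D; resp to respD)
    open Subgroup Im  renaming (_∈ to _∈I; resp to respI)
    field
      fun-cong : ∀ {x y} → x ∈D → x ≈ y → fun x ≈ fun y
      inv-cong : ∀ {x y} → x ∈I → x ≈ y → inv x ≈ inv y
      fun-∈    : ∀ {x} → x ∈D → fun x ∈I
      inv-∈    : ∀ {y} → y ∈I → inv y ∈D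
      inv-fun  : ∀ {x} → x ∈D → inv (fun x) ≈ x
      fun-inv  : ∀ {y} → y ∈I → fun (inv y) ≈ y
      fun-hom  : ∀ {x y} → x ∈D → y ∈D → fun (x ∙ y) ≈ fun x ∙ fun y

  open PartialAut public

  module Facts (φ : PartialAut) where
    open Subgroup (Dom φ) renaming (_∈ to _∈D; resp to respD; ε∈ to εD; ∙∈ to ∙D; ⁻¹∈ to ⁻¹D)
    open Subgroup (Im φ)  renaming (_∈ to _∈I; resp to respI; ε∈ to εI; ∙∈ to ∙I; ⁻¹∈ to ⁻¹I)

    idem⇒ε : ∀ a → a ≈ a ∙ a → a ≈ ε
    idem⇒ε a h = sym (begin
      ε               ≈⟨ sym (inverseˡ a) ⟩
      a ⁻¹ ∙ a        ≈⟨ ∙-congˡ h ⟩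
      a ⁻¹ ∙ (a ∙ a)  ≈⟨ sym (assoc (a ⁻¹) a a) ⟩
      (a ⁻¹ ∙ a) ∙ a  ≈⟨ ∙-congʳ (inverseˡ a) ⟩
      ε ∙ a           ≈⟨ identityˡ a ⟩
      a ∎)

    fun-ε : fun φ ε ≈ ε
    fun-ε = idem⇒ε (fun φ ε)
      (trans (fun-cong φ εD (sym (identityˡ ε))) (fun-hom φ εD εD))

    fun-⁻¹ : ∀ {x} → x ∈D → fun φ (x ⁻¹) ≈ (fun φ x) ⁻¹
    fun-⁻¹ {x} h = inverseʳ-unique (fun φ x) (fun φ (x ⁻¹))
      (trans (sym (fun-hom φ h (⁻¹D h)))
        (trans (fun-cong φ (∙D h (⁻¹D h)) (inverseʳ x)) fun-ε))

    inv-hom : ∀ {x y} → x ∈I → y ∈I → inv φ (x ∙ y) ≈ inv φ x ∙ inv φ y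
    inv-hom {x} {y} hx hy = begin
      inv φ (x ∙ y)                               ≈⟨ inv-cong φ (∙I hx hy)
                                                      (sym (∙-cong (fun-inv φ hx) (fun-inv φ hy))) ⟩
      inv φ (fun φ (inv φ x) ∙ fun φ (inv φ y))   ≈⟨ inv-cong φ
                                                      (∙I (fun-∈ φ (inv-∈ φ hx)) (fun-∈ φ (inv-∈ φ hy)))
                                                      (sym (fun-hom φ (inv-∈ φ hx) (inv-∈ φ hy))) ⟩
      inv φ (fun φ (inv φ x ∙ inv φ y))           ≈⟨ inv-fun φ (∙D (inv-∈ φ hx) (inv-∈ φ hy)) ⟩
      inv φ x ∙ inv φ y ∎

  _⁻¹ᵖ : PartialAut → PartialAut
  φ ⁻¹ᵖ = record
    { Dom = Im φ ; Im = Dom φ ; fun = inv φ ; inv = fun φ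
    ; fun-cong = inv-cong φ ; inv-cong = fun-cong φ
    ; fun-∈ = inv-∈ φ ; inv-∈ = fun-∈ φ
    ; inv-fun = fun-inv φ ; fun-inv = inv-fun φ
    ; fun-hom = Facts.inv-hom φ }

  preimage : (φ : PartialAut) → Subgroup p → Subgroup p
  preimage φ K = record
    { _∈ = λ x → (x ∈D) × (fun φ x ∈K)
    ; resp = λ x≈y (hx , hk) → respD x≈y hx , respK (fun-cong φ hx x≈y) hk
    ; ε∈ = εD , respK (sym (Facts.fun-ε φ)) εK
    ; ∙∈ = λ (hx , kx) (hy , ky) → ∙D hx hy , respK (sym (fun-hom φ hx hy)) (∙K kx ky)
    ; ⁻¹∈ = λ (hx , kx) → ⁻¹D hx , respK (sym (Facts.fun-⁻¹ φ hx)) (⁻¹K kx) }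
    where
    open Subgroup (Dom φ) renaming (_∈ to _∈D; resp to respD; ε∈ to εD; ∙∈ to ∙D; ⁻¹∈ to ⁻¹D)
    open Subgroup K renaming (_∈ to _∈K; resp to respK; ε∈ to εK; ∙∈ to ∙K; ⁻¹∈ to ⁻¹K)

  -- composition φψ (first φ, then ψ):
  --   Dom(φψ) = (Im φ ∩ Dom ψ) φ⁻¹ ,  Im(φψ) = (Im φ ∩ Dom ψ) ψ
  _∘ᵖ_ : PartialAut → PartialAut → PartialAut
  φ ∘ᵖ ψ = record
    { Dom = preimage φ (Dom ψ)
    ; Im  = preimage (ψ ⁻¹ᵖ) (Im φ)
    ; fun = λ x → fun ψ (fun φ x)
    ; inv = λ y → inv φ (inv ψ y)
    ; fun-cong = λ (hx , kx) x≈y → fun-cong ψ kx (fun-cong φ hx x≈y)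
    ; inv-cong = λ (hy , ky) x≈y → inv-cong φ ky (inv-cong ψ hy x≈y)
    ; fun-∈ = λ (hx , kx) → fun-∈ ψ kx
                , Subgroup.resp (Im φ) (sym (inv-fun ψ kx)) (fun-∈ φ hx)
    ; inv-∈ = λ (hy , ky) → inv-∈ φ ky
                , Subgroup.resp (Dom ψ) (sym (fun-inv φ ky)) (inv-∈ ψ hy)
    ; inv-fun = λ (hx , kx) → trans (sym (inv-cong φ (fun-∈ φ hx) (sym (inv-fun ψ kx)))) (inv-fun φ hx)
    ; fun-inv = λ (hy , ky) → trans (sym (fun-cong ψ (inv-∈ ψ hy) (sym (fun-inv φ ky)))) (fun-inv ψ hy)
    ; fun-hom = λ (hx , kx) (hy , ky) →
        trans (fun-cong ψ (Subgroup.resp (Dom ψ) (sym (fun-hom φ hx hy)) (Subgroup.∙∈ (Dom ψ) kx ky))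
                          (fun-hom φ hx hy))
              (fun-hom ψ kx ky)
    }

  whole : Subgroup p
  whole = record { _∈ = λ _ → ⊤ ; resp = λ _ _ → tt ; ε∈ = tt ; ∙∈ = λ _ _ → tt ; ⁻¹∈ = λ _ → tt }

  idᵖ : PartialAut
  idᵖ = record
    { Dom = whole ; Im = whole ; fun = λ x → x ; inv = λ x → x
    ; fun-cong = λ _ e → e ; inv-cong = λ _ e → e
    ; fun-∈ = λ _ → tt ; inv-∈ = λ _ → tt
    ; inv-fun = λ _ → refl ; fun-inv = λ _ → refl
    ; fun-hom = λ _ _ → refl }

  negᵖ : PartialAut
  negᵖ = record
    { Dom = whole ; Im = whole ; fun = _⁻¹ ; inv = _⁻¹
    ; fun-cong = λ _ e → ⁻¹-cong e ; inv-cong = λ _ e → ⁻¹-cong e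
    ; fun-∈ = λ _ → tt ; inv-∈ = λ _ → tt
    ; inv-fun = λ _ → ⁻¹-involutive _ ; fun-inv = λ _ → ⁻¹-involutive _
    ; fun-hom = λ {x} {y} _ _ → sym (⁻¹-∙-comm x y) }

  InPAut : PartialAut → Set (lsuc c ⊔ lsuc p)
  InPAut φ = GroupNotions.ℵ₁-Free (G / Dom φ) × GroupNotions.ℵ₁-Free (G / Im φ)

{-# OPTIONS --safe #-}
module Submission where

-- Weak inversion swaps domain and image, and ±id have trivial quotients, so the content lies in
-- composition, whose domain and image both have the form D = {x ∈ Dom φ : xφ ∈ E}.  It suffices
-- that G/D is ℵ₁-free when G/Dom φ and G/E are.  Inside G/D the subgroup N = Dom φ/D has
-- quotient G/Dom φ, and φ embeds N into G/E.  Hence a countable S ≤ G/D has a countable image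
-- in G/Dom φ and a countable part S ∩ N embedding into G/E, and both are free.  Lifting a basis
-- of the image back into S and adjoining a basis of S ∩ N gives a basis of S, just as a free
-- quotient splits off.  Excluded middle is used to enumerate S ∩ N and to push image predicates
-- down to the level subgroups live at.

open import Defs
open import Level using (_⊔_; Lift; lift; lower)
open import Algebra.Bundles using (AbelianGroup)
open import Data.Nat using (ℕ; zero; suc; _+_)
open import Data.Integer using (ℤ; +_; -[1+_]; 0ℤ)
open import Data.Fin using (Fin; zero; suc; splitAt)
open import Data.Fin.Properties using (suc-injective)
open import Data.Vec.Functional using (_∷_; _++_)
open import Data.Product using (Σ-syntax; ∃; _×_; _,_; proj₁; proj₂)
import Data.Product as Product
open import Data.Sum using (_⊎_; inj₁; inj₂; [_,_])
import Data.Sum as Sum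
open import Data.Sum.Properties using ([,]-map)
open import Function using (_∘_; id)
open import Axiom.ExcludedMiddle using (ExcludedMiddle)
open import Data.Empty using (⊥-elim)
open import Data.Empty.Polymorphic using (⊥)
open import Relation.Nullary using (Dec; yes; no)
open import Relation.Nullary.Decidable using (True; toWitness; fromWitness; map′)
open import Function.Definitions using (Injective)
open import Relation.Binary.PropositionalEquality as ≡ using (_≡_)
import Relation.Binary.Reasoning.Setoid as SetoidReasoning
import Algebra.Properties.AbelianGroup as AbelianGroupProperties
import Algebra.Properties.CommutativeSemigroup as CommutativeSemigroupProperties

module LinearCombinations {a ℓ} (A : AbelianGroup a ℓ) where
  open AbelianGroup A
  open GroupNotions A
  open SetoidReasoning setoid

  ×ℕ-cong : ∀ n {x y} → x ≈ y → n ×ℕ x ≈ n ×ℕ y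
  ×ℕ-cong zero    x≈y = refl
  ×ℕ-cong (suc n) x≈y = ∙-cong x≈y (×ℕ-cong n x≈y)

  ·-cong : ∀ z {x y} → x ≈ y → z · x ≈ z · y
  ·-cong (+ n)    x≈y = ×ℕ-cong n x≈y
  ·-cong -[1+ n ] x≈y = ⁻¹-cong (×ℕ-cong (suc n) x≈y)

  ∑-cong : ∀ n {f g : Fin n → Carrier} → (∀ k → f k ≈ g k) → ∑ n f ≈ ∑ n g
  ∑-cong zero    f≈g = refl
  ∑-cong (suc n) f≈g = ∙-cong (f≈g zero) (∑-cong n (f≈g ∘ suc))

  ∑-++ : ∀ m {n} (f : Fin m → Carrier) (g : Fin n → Carrier) →
         ∑ (m + n) (f ++ g) ≈ ∑ m f ∙ ∑ n g
  ∑-++ zero    f g = sym (identityˡ _)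
  ∑-++ (suc m) {n} f g = begin
    f zero ∙ ∑ (m + n) ((f ++ g) ∘ suc)
      ≈⟨ ∙-congˡ (∑-cong (m + n) (reflexive ∘ [,]-map ∘ splitAt m)) ⟩
    f zero ∙ ∑ (m + n) ((f ∘ suc) ++ g)    ≈⟨ ∙-congˡ (∑-++ m (f ∘ suc) g) ⟩
    f zero ∙ (∑ m (f ∘ suc) ∙ ∑ n g)       ≈⟨ assoc _ _ _ ⟨
    f zero ∙ ∑ m (f ∘ suc) ∙ ∑ n g         ∎

  module _ {i} {I : Set i} where
    combination : (I → Carrier) → (n : ℕ) → (Fin n → I) → (Fin n → ℤ) → Carrier
    combination b n idx coef = ∑ n (λ k → coef k · b (idx k))

    _∈Span_ : Carrier → (I → Carrier) → Set (ℓ ⊔ i)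
    x ∈Span b = Σ[ n ∈ ℕ ] Σ[ idx ∈ (Fin n → I) ] Σ[ coef ∈ (Fin n → ℤ) ]
                  x ≈ combination b n idx coef

    combination-cong : ∀ {b b′ : I → Carrier} → (∀ i → b i ≈ b′ i) →
                       ∀ n idx coef → combination b n idx coef ≈ combination b′ n idx coef
    combination-cong b≈b′ n idx coef = ∑-cong n (λ k → ·-cong (coef k) (b≈b′ (idx k)))

    combination-zero : ∀ (b : I → Carrier) n idx {coef} → (∀ k → coef k ≡ 0ℤ) →
                       combination b n idx coef ≈ ε
    combination-zero b zero    idx         coef≡0 = refl
    combination-zero b (suc n) idx {coef} coef≡0 = begin
      coef zero · b (idx zero) ∙ combination b n (idx ∘ suc) (coef ∘ suc)
        ≈⟨ ∙-cong (reflexive (≡.cong (λ z → z · b (idx zero)) (coef≡0 zero)))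
                  (combination-zero b n (idx ∘ suc) (coef≡0 ∘ suc)) ⟩
      ε ∙ ε  ≈⟨ identityˡ ε ⟩
      ε      ∎

    ∈Span-cong : ∀ {b b′ : I → Carrier} → (∀ i → b i ≈ b′ i) → ∀ {x} → x ∈Span b → x ∈Span b′
    ∈Span-cong b≈b′ (n , idx , coef , x≈) =
      n , idx , coef , trans x≈ (combination-cong b≈b′ n idx coef)

  module _ {I : Set a} where
    Independent : (I → Carrier) → Set (a ⊔ ℓ)
    Independent b = ∀ n idx coef → InjectiveFin idx →
                    combination b n idx coef ≈ ε → ∀ k → coef k ≡ 0ℤ

    Independent-cong : ∀ {b b′ : I → Carrier} → (∀ i → b i ≈ b′ i) → Independent b → Independent b′
    Independent-cong b≈b′ indep n idx coef inj comb≈ε =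
      indep n idx coef inj (trans (combination-cong b≈b′ n idx coef) comb≈ε)

  _⊆_ : ∀ {q₁ q₂} → Subgroup q₁ → Subgroup q₂ → Set (a ⊔ q₁ ⊔ q₂)
  U ⊆ V = ∀ {x} → x ∈U → x ∈V
    where open Subgroup U renaming (_∈ to _∈U)
          open Subgroup V renaming (_∈ to _∈V)

  module _ {q} (U : Subgroup q) where
    open Subgroup U

    ×ℕ∈ : ∀ n {x} → x ∈ → (n ×ℕ x) ∈
    ×ℕ∈ zero    x∈ = ε∈
    ×ℕ∈ (suc n) x∈ = ∙∈ x∈ (×ℕ∈ n x∈)

    ·∈ : ∀ z {x} → x ∈ → (z · x) ∈
    ·∈ (+ n)    x∈ = ×ℕ∈ n x∈
    ·∈ -[1+ n ] x∈ = ⁻¹∈ (×ℕ∈ (suc n) x∈)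

    ∑∈ : ∀ n {f : Fin n → Carrier} → (∀ k → f k ∈) → ∑ n f ∈
    ∑∈ zero    f∈ = ε∈
    ∑∈ (suc n) f∈ = ∙∈ (f∈ zero) (∑∈ n (f∈ ∘ suc))

    combination∈ : ∀ {i} {I : Set i} {b : I → Carrier} → (∀ i → b i ∈) →
                   ∀ n idx coef → combination b n idx coef ∈
    combination∈ b∈ n idx coef = ∑∈ n (λ k → ·∈ (coef k) (b∈ (idx k)))

    ∈Span⇒∈ : ∀ {i} {I : Set i} {b : I → Carrier} → (∀ i → b i ∈) → ∀ {x} → x ∈Span b → x ∈
    ∈Span⇒∈ b∈ (n , idx , coef , x≈) = resp (sym x≈) (combination∈ b∈ n idx coef)

  module _ {I₁ I₂ : Set a} where

    record Partition {n} (idx : Fin n → I₁ ⊎ I₂) : Set (a ⊔ ℓ) where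
      field
        m₁ m₂        : ℕ
        p₁           : Fin m₁ → Fin n
        p₂           : Fin m₂ → Fin n
        l₁           : Fin m₁ → I₁
        l₂           : Fin m₂ → I₂
        idx∘p₁       : ∀ k → idx (p₁ k) ≡ inj₁ (l₁ k)
        idx∘p₂       : ∀ k → idx (p₂ k) ≡ inj₂ (l₂ k)
        p₁-injective : Injective _≡_ _≡_ p₁
        p₂-injective : Injective _≡_ _≡_ p₂
        cover        : ∀ k → (∃ λ k′ → p₁ k′ ≡ k) ⊎ (∃ λ k′ → p₂ k′ ≡ k)
        ∑-partition  : ∀ g → ∑ n g ≈ ∑ m₁ (g ∘ p₁) ∙ ∑ m₂ (g ∘ p₂)

    private
      zero∷suc∘-injective : ∀ {m n} {p : Fin m → Fin n} →
                            Injective _≡_ _≡_ p → Injective _≡_ _≡_ (zero ∷ suc ∘ p)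
      zero∷suc∘-injective p-inj {zero}  {zero}  _  = ≡.refl
      zero∷suc∘-injective p-inj {suc i} {suc j} eq = ≡.cong suc (p-inj (suc-injective eq))

      suc∘-injective : ∀ {m n} {p : Fin m → Fin n} →
                       Injective _≡_ _≡_ p → Injective _≡_ _≡_ (suc ∘ p)
      suc∘-injective p-inj = p-inj ∘ suc-injective

      cover-suc : ∀ {m n} {p : Fin m → Fin n} {k} →
                  (∃ λ k′ → p k′ ≡ k) → ∃ λ k′ → suc (p k′) ≡ suc k
      cover-suc = Product.map₂ (≡.cong suc)

      cover-zero∷ : ∀ {m n} {p : Fin m → Fin n} {k} → (∃ λ k′ → p k′ ≡ k) →
                    ∃ λ k′ → (zero ∷ suc ∘ p) k′ ≡ suc k
      cover-zero∷ (k′ , eq) = suc k′ , ≡.cong suc eq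

      cons₁ : ∀ {n} {idx : Fin (suc n) → I₁ ⊎ I₂} {i} →
              idx zero ≡ inj₁ i → Partition (idx ∘ suc) → Partition idx
      cons₁ {i = i} eq P = record
        { m₁ = suc m₁ ; m₂ = m₂
        ; p₁ = zero ∷ suc ∘ p₁ ; p₂ = suc ∘ p₂
        ; l₁ = i ∷ l₁ ; l₂ = l₂
        ; idx∘p₁ = λ { zero → eq ; (suc k) → idx∘p₁ k }
        ; idx∘p₂ = idx∘p₂
        ; p₁-injective = zero∷suc∘-injective p₁-injective
        ; p₂-injective = suc∘-injective p₂-injective
        ; cover = λ { zero    → inj₁ (zero , ≡.refl)
                    ; (suc k) → Sum.map cover-zero∷ cover-suc (cover k) }
        ; ∑-partition = λ g → trans (∙-congˡ (∑-partition (g ∘ suc))) (sym (assoc _ _ _))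
        }
        where open Partition P

      cons₂ : ∀ {n} {idx : Fin (suc n) → I₁ ⊎ I₂} {j} →
              idx zero ≡ inj₂ j → Partition (idx ∘ suc) → Partition idx
      cons₂ {j = j} eq P = record
        { m₁ = m₁ ; m₂ = suc m₂
        ; p₁ = suc ∘ p₁ ; p₂ = zero ∷ suc ∘ p₂
        ; l₁ = l₁ ; l₂ = j ∷ l₂
        ; idx∘p₁ = idx∘p₁
        ; idx∘p₂ = λ { zero → eq ; (suc k) → idx∘p₂ k }
        ; p₁-injective = suc∘-injective p₁-injective
        ; p₂-injective = zero∷suc∘-injective p₂-injective
        ; cover = λ { zero    → inj₂ (zero , ≡.refl)
                    ; (suc k) → Sum.map cover-suc cover-zero∷ (cover k) }
        ; ∑-partition = λ g → trans (∙-congˡ (∑-partition (g ∘ suc))) (x∙yz≈y∙xz (g zero) _ _)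
        }
        where open Partition P
              open CommutativeSemigroupProperties commutativeSemigroup using (x∙yz≈y∙xz)

    partition : ∀ {n} (idx : Fin n → I₁ ⊎ I₂) → Partition idx
    partition {zero} idx = record
      { m₁ = 0 ; m₂ = 0 ; p₁ = λ () ; p₂ = λ () ; l₁ = λ () ; l₂ = λ ()
      ; idx∘p₁ = λ () ; idx∘p₂ = λ () ; p₁-injective = λ {} ; p₂-injective = λ {}
      ; cover = λ () ; ∑-partition = λ _ → sym (identityˡ ε) }
    partition {suc n} idx with idx zero in eq
    ... | inj₁ i = cons₁ eq (partition (idx ∘ suc))
    ... | inj₂ j = cons₂ eq (partition (idx ∘ suc))

    ∈Span-⊎ : ∀ {b : I₁ ⊎ I₂ → Carrier} {x y₁ y₂} → x ≈ y₁ ∙ y₂ →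
              y₁ ∈Span (b ∘ inj₁) → y₂ ∈Span (b ∘ inj₂) → x ∈Span b
    ∈Span-⊎ {b} {x} x≈y₁y₂ (n₁ , idx₁ , coef₁ , y₁≈) (n₂ , idx₂ , coef₂ , y₂≈) =
      n₁ + n₂ , idx , coef , (begin
        x                                 ≈⟨ trans x≈y₁y₂ (∙-cong y₁≈ y₂≈) ⟩
        ∑ n₁ term₁ ∙ ∑ n₂ term₂           ≈⟨ ∑-++ n₁ term₁ term₂ ⟨
        ∑ (n₁ + n₂) (term₁ ++ term₂)      ≈⟨ ∑-cong (n₁ + n₂) (reflexive ∘ term-++ ∘ splitAt n₁) ⟩
        combination b (n₁ + n₂) idx coef  ∎)
      where
      idx : Fin (n₁ + n₂) → I₁ ⊎ I₂
      idx = (inj₁ ∘ idx₁) ++ (inj₂ ∘ idx₂)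
      coef : Fin (n₁ + n₂) → ℤ
      coef = coef₁ ++ coef₂
      term₁ : Fin n₁ → Carrier
      term₁ k = coef₁ k · b (inj₁ (idx₁ k))
      term₂ : Fin n₂ → Carrier
      term₂ k = coef₂ k · b (inj₂ (idx₂ k))
      term-++ : ∀ v → [ term₁ , term₂ ] v ≡
                      [ coef₁ , coef₂ ] v · b ([ inj₁ ∘ idx₁ , inj₂ ∘ idx₂ ] v)
      term-++ (inj₁ _) = ≡.refl
      term-++ (inj₂ _) = ≡.refl

    Independent-⊎ : ∀ {b : I₁ ⊎ I₂ → Carrier} →
      (∀ {m₁ m₂} l₁ c₁ l₂ c₂ → InjectiveFin l₁ → InjectiveFin l₂ →
         combination (b ∘ inj₁) m₁ l₁ c₁ ∙ combination (b ∘ inj₂) m₂ l₂ c₂ ≈ ε →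
         (∀ k → c₁ k ≡ 0ℤ) × (∀ k → c₂ k ≡ 0ℤ)) →
      Independent b
    Independent-⊎ {b} separated n idx coef idx-injective comb≈ε k =
      [ vanishes (proj₁ zeros) , vanishes (proj₂ zeros) ] (cover k)
      where
      open Partition (partition idx)
      split : combination b n idx coef ≈
              combination (b ∘ inj₁) m₁ l₁ (coef ∘ p₁) ∙ combination (b ∘ inj₂) m₂ l₂ (coef ∘ p₂)
      split = trans (∑-partition _) (∙-cong
        (∑-cong m₁ (λ k → reflexive (≡.cong (λ v → coef (p₁ k) · b v) (idx∘p₁ k))))
        (∑-cong m₂ (λ k → reflexive (≡.cong (λ v → coef (p₂ k) · b v) (idx∘p₂ k)))))
      l₁-injective : InjectiveFin l₁
      l₁-injective i j eq = p₁-injective (idx-injective _ _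
        (≡.trans (idx∘p₁ i) (≡.trans (≡.cong inj₁ eq) (≡.sym (idx∘p₁ j)))))
      l₂-injective : InjectiveFin l₂
      l₂-injective i j eq = p₂-injective (idx-injective _ _
        (≡.trans (idx∘p₂ i) (≡.trans (≡.cong inj₂ eq) (≡.sym (idx∘p₂ j)))))
      zeros : (∀ k → coef (p₁ k) ≡ 0ℤ) × (∀ k → coef (p₂ k) ≡ 0ℤ)
      zeros = separated l₁ (coef ∘ p₁) l₂ (coef ∘ p₂) l₁-injective l₂-injective
                        (trans (sym split) comb≈ε)
      vanishes : ∀ {m} {p : Fin m → Fin n} →
                 (∀ k′ → coef (p k′) ≡ 0ℤ) → (∃ λ k′ → p k′ ≡ k) → coef k ≡ 0ℤ
      vanishes coef∘p≡0 (k′ , ≡.refl) = coef∘p≡0 k′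

module _ {a₁ ℓ₁ a₂ ℓ₂} (A : AbelianGroup a₁ ℓ₁) (B : AbelianGroup a₂ ℓ₂) where
  private
    module A = AbelianGroup A
    module B = AbelianGroup B

  record HomOn {q} (U : GroupNotions.Subgroup A q) (f : A.Carrier → B.Carrier)
               : Set (a₁ ⊔ ℓ₁ ⊔ ℓ₂ ⊔ q) where
    open GroupNotions.Subgroup U
    field
      cong : ∀ {x y} → x ∈ → x A.≈ y → f x B.≈ f y
      homo : ∀ {x y} → x ∈ → y ∈ → f (x A.∙ y) B.≈ f x B.∙ f y

module HomOnProperties {a₁ ℓ₁ a₂ ℓ₂ q} {A : AbelianGroup a₁ ℓ₁} {B : AbelianGroup a₂ ℓ₂}
                       {U : GroupNotions.Subgroup A q} {f} (f-hom : HomOn A B U f) where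
  private
    module A = AbelianGroup A
    module NA = GroupNotions A
    module LA = LinearCombinations A
  open AbelianGroup B
  open GroupNotions B
  open LinearCombinations B
  open AbelianGroupProperties B using (identityˡ-unique; inverseʳ-unique)
  open SetoidReasoning setoid
  open NA.Subgroup U
  open HomOn f-hom

  ε-homo : f A.ε ≈ ε
  ε-homo = identityˡ-unique (f A.ε) (f A.ε) (sym (begin
    f A.ε                ≈⟨ cong ε∈ (A.sym (A.identityˡ A.ε)) ⟩
    f (A.ε A.∙ A.ε)      ≈⟨ homo ε∈ ε∈ ⟩
    f A.ε ∙ f A.ε        ∎))

  ⁻¹-homo : ∀ {x} → x ∈ → f (x A.⁻¹) ≈ f x ⁻¹
  ⁻¹-homo {x} x∈ = inverseʳ-unique (f x) (f (x A.⁻¹)) (begin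
    f x ∙ f (x A.⁻¹)     ≈⟨ homo x∈ (⁻¹∈ x∈) ⟨
    f (x A.∙ x A.⁻¹)     ≈⟨ cong (∙∈ x∈ (⁻¹∈ x∈)) (A.inverseʳ x) ⟩
    f A.ε                ≈⟨ ε-homo ⟩
    ε                    ∎)

  ×ℕ-homo : ∀ n {x} → x ∈ → f (n NA.×ℕ x) ≈ n ×ℕ f x
  ×ℕ-homo zero    x∈ = ε-homo
  ×ℕ-homo (suc n) x∈ = trans (homo x∈ (LA.×ℕ∈ U n x∈)) (∙-congˡ (×ℕ-homo n x∈))

  ·-homo : ∀ z {x} → x ∈ → f (z NA.· x) ≈ z · f x
  ·-homo (+ n)    x∈ = ×ℕ-homo n x∈
  ·-homo -[1+ n ] x∈ = trans (⁻¹-homo (LA.×ℕ∈ U (suc n) x∈)) (⁻¹-cong (×ℕ-homo (suc n) x∈))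

  ∑-homo : ∀ n {g : Fin n → A.Carrier} → (∀ k → g k ∈) → f (NA.∑ n g) ≈ ∑ n (f ∘ g)
  ∑-homo zero    g∈ = ε-homo
  ∑-homo (suc n) g∈ = trans (homo (g∈ zero) (LA.∑∈ U n (g∈ ∘ suc))) (∙-congˡ (∑-homo n (g∈ ∘ suc)))

  combination-homo : ∀ {i} {I : Set i} {b : I → A.Carrier} → (∀ i → b i ∈) → ∀ n idx coef →
                     f (LA.combination b n idx coef) ≈ combination (f ∘ b) n idx coef
  combination-homo b∈ n idx coef = trans (∑-homo n (λ k → LA.·∈ U (coef k) (b∈ (idx k))))
                                         (∑-cong n (λ k → ·-homo (coef k) (b∈ (idx k))))

  restrict : ∀ {q′} {V : NA.Subgroup q′} → LA._⊆_ V U → HomOn A B V f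
  restrict V⊆U = record { cong = cong ∘ V⊆U ; homo = λ x∈ y∈ → homo (V⊆U x∈) (V⊆U y∈) }

module Intersection {a ℓ} (A : AbelianGroup a ℓ) where
  open AbelianGroup A
  open GroupNotions A

  module _ {q₁ q₂} (U : Subgroup q₁) (V : Subgroup q₂) where
    open Subgroup U renaming (_∈ to _∈U; resp to respU; ε∈ to ε∈U; ∙∈ to ∙∈U; ⁻¹∈ to ⁻¹∈U)
    open Subgroup V renaming (_∈ to _∈V; resp to respV; ε∈ to ε∈V; ∙∈ to ∙∈V; ⁻¹∈ to ⁻¹∈V)

    _∩_ : Subgroup (q₁ ⊔ q₂)
    _∩_ = record
      { _∈  = λ x → x ∈U × x ∈V
      ; resp = λ x≈y → Product.map (respU x≈y) (respV x≈y)
      ; ε∈  = ε∈U , ε∈V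
      ; ∙∈  = Product.zip ∙∈U ∙∈V
      ; ⁻¹∈ = Product.map ⁻¹∈U ⁻¹∈V
      }

    ∩-countable : Countable U → (∀ x → Dec (x ∈V)) → Countable _∩_
    ∩-countable (e , e∈U , e-onto) _∈V? =
      (λ n → keepIf (e n ∈V?)) , (λ n → keepIf∈ (e∈U n) (e n ∈V?)) , onto
      where
      keepIf : ∀ {x} → Dec (x ∈V) → Carrier
      keepIf {x} (yes _) = x
      keepIf     (no  _) = ε
      keepIf∈ : ∀ {x} → x ∈U → (x∈V? : Dec (x ∈V)) → keepIf x∈V? ∈U × keepIf x∈V? ∈V
      keepIf∈ x∈U (yes x∈V) = x∈U , x∈V
      keepIf∈ x∈U (no  _)   = ε∈U , ε∈V
      kept : ∀ {x y} → x ∈V → x ≈ y → (y∈V? : Dec (y ∈V)) → x ≈ keepIf y∈V?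
      kept x∈V x≈y (yes _)   = x≈y
      kept x∈V x≈y (no  y∉V) = ⊥-elim (y∉V (respV x≈y x∈V))
      onto : ∀ x → x ∈U × x ∈V → ∃ λ n → x ≈ keepIf (e n ∈V?)
      onto x (x∈U , x∈V) = let (n , x≈en) = e-onto x x∈U in n , kept x∈V x≈en (e n ∈V?)

excludedMiddle-lower : ∀ {a b} → ExcludedMiddle (a ⊔ b) → ExcludedMiddle a
excludedMiddle-lower {b = b} em {P} = map′ lower lift (em {Lift b P})

-- Under excluded middle every proposition is equivalent to a Boolean one, which can be lifted
-- to any universe level.
module Resizing {e} (em : ExcludedMiddle e) where

  Resized : ∀ r → Set e → Set r
  Resized r P = Lift r (True (em {P}))

  resize : ∀ {r} {P : Set e} → P → Resized r P
  resize p = lift (fromWitness p)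

  unresize : ∀ {r} {P : Set e} → Resized r P → P
  unresize (lift t) = toWitness t

module Image {a₁ ℓ₁ a₂ ℓ₂ q} {A : AbelianGroup a₁ ℓ₁} {B : AbelianGroup a₂ ℓ₂}
             (em : ExcludedMiddle (a₁ ⊔ q ⊔ ℓ₂))
             (U : GroupNotions.Subgroup A q) {f} (f-hom : HomOn A B U f) where
  private
    module A = AbelianGroup A
  open AbelianGroup B
  open GroupNotions B
  open GroupNotions.Subgroup U renaming (_∈ to _∈U)
  open HomOn f-hom
  open HomOnProperties f-hom using (ε-homo; ⁻¹-homo)
  open Resizing em

  HasPreimage : Carrier → Set (a₁ ⊔ q ⊔ ℓ₂)
  HasPreimage y = Σ[ x ∈ A.Carrier ] (x ∈U × y ≈ f x)

  image : Subgroup ℓ₂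
  image = record
    { _∈  = λ y → Resized ℓ₂ (HasPreimage y)
    ; resp = λ y≈y′ y∈ → let (x , x∈ , y≈fx) = unresize y∈ in
                         resize (x , x∈ , trans (sym y≈y′) y≈fx)
    ; ε∈  = resize (A.ε , ε∈ , sym ε-homo)
    ; ∙∈  = λ y∈ y′∈ → let (x , x∈ , y≈fx) = unresize y∈ ; (x′ , x′∈ , y′≈fx′) = unresize y′∈ in
                       resize (x A.∙ x′ , ∙∈ x∈ x′∈ ,
                               trans (∙-cong y≈fx y′≈fx′) (sym (homo x∈ x′∈)))
    ; ⁻¹∈ = λ y∈ → let (x , x∈ , y≈fx) = unresize y∈ in
                   resize (x A.⁻¹ , ⁻¹∈ x∈ , trans (⁻¹-cong y≈fx) (sym (⁻¹-homo x∈)))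
    }

  image-intro : ∀ {x} → x ∈U → Subgroup._∈ image (f x)
  image-intro x∈ = resize (_ , x∈ , refl)

  image-elim : ∀ {y} → Subgroup._∈ image y → HasPreimage y
  image-elim = unresize

  image-countable : GroupNotions.Countable A U → Countable image
  image-countable (e , e∈ , e-onto) = f ∘ e , image-intro ∘ e∈ , onto
    where
    onto : ∀ y → Subgroup._∈ image y → ∃ λ n → y ≈ f (e n)
    onto y y∈ = let (x , x∈ , y≈fx) = image-elim y∈ ; (n , x≈en) = e-onto x x∈ in
                n , trans y≈fx (cong x∈ x≈en)

module Extension {a ℓ} (em : ExcludedMiddle (a ⊔ ℓ)) {A C B : AbelianGroup a ℓ}
                 (N : GroupNotions.Subgroup A ℓ) where
  private
    module C = AbelianGroup C
    module B = AbelianGroup B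
    module LC = LinearCombinations C
    module LB = LinearCombinations B
  open AbelianGroup A
  open GroupNotions A
  open LinearCombinations A
  open Intersection A
  open Subgroup N using () renaming (_∈ to _∈N)
  open PartialAutomorphisms A ℓ using (whole)

  module _ {π} (π-hom : HomOn A C whole π)
           (N⊆ker : ∀ {x} → x ∈N → π x C.≈ C.ε) (ker⊆N : ∀ {x} → π x C.≈ C.ε → x ∈N)
           {f} (f-hom : HomOn A B N f)
           (f-injective : ∀ {x y} → x ∈N → y ∈N → f x B.≈ f y → x ≈ y) where
    private
      module π = HomOn π-hom
      module f = HomOn f-hom
      module πP = HomOnProperties π-hom
      module fP = HomOnProperties f-hom

    lift-span : ∀ {I : Set a} {s : I → Carrier} {x} → π x LC.∈Span (π ∘ s) →
                Σ[ y ∈ Carrier ] (y ∈Span s × (x ∙ y ⁻¹) ∈N)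
    lift-span {s = s} {x} (n , idx , coef , πx≈) = y , (n , idx , coef , refl) , ker⊆N (begin
        π (x ∙ y ⁻¹)      ≈⟨ π.homo _ _ ⟩
        π x C.∙ π (y ⁻¹)  ≈⟨ C.∙-congˡ (πP.⁻¹-homo _) ⟩
        π x C.∙ π y C.⁻¹  ≈⟨ x≈y⇒x∙y⁻¹≈ε πx≈πy ⟩
        C.ε               ∎)
      where
      open SetoidReasoning C.setoid
      open AbelianGroupProperties C using (x≈y⇒x∙y⁻¹≈ε)
      y : Carrier
      y = combination s n idx coef
      πx≈πy : π x C.≈ π y
      πx≈πy = C.trans πx≈ (C.sym (πP.combination-homo {b = s} _ n idx coef))

    reflect-span : ∀ {I : Set a} {t : I → Carrier} → (∀ j → t j ∈N) →
                   ∀ {x} → x ∈N → f x LB.∈Span (f ∘ t) → x ∈Span t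
    reflect-span t∈N x∈N (n , idx , coef , fx≈) = n , idx , coef ,
      f-injective x∈N (combination∈ N t∈N n idx coef)
                  (B.trans fx≈ (B.sym (fP.combination-homo t∈N n idx coef)))

    spans-extension : ∀ {S : Subgroup ℓ} {I₁ I₂ : Set a} {s : I₁ → Carrier} {t : I₂ → Carrier} →
      let open Subgroup S renaming (_∈ to _∈S) in
      (∀ i → s i ∈S) → (∀ j → t j ∈N) →
      (∀ {x} → x ∈S → π x LC.∈Span (π ∘ s)) → (∀ {x} → x ∈S → x ∈N → f x LB.∈Span (f ∘ t)) →
      ∀ {x} → x ∈S → x ∈Span [ s , t ]
    spans-extension {S} {s = s} {t} s∈S t∈N π-spans f-spans {x} x∈S =
      let (y , y∈Span , x/y∈N) = lift-span {s = s} (π-spans x∈S)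
          x/y∈S = ∙∈ x∈S (⁻¹∈ (∈Span⇒∈ S s∈S y∈Span))
      in ∈Span-⊎ {b = [ s , t ]} (x≈y∙x/y y) y∈Span (reflect-span t∈N x/y∈N (f-spans x/y∈S x/y∈N))
      where
      open Subgroup S
      x≈y∙x/y : ∀ y → x ≈ y ∙ (x ∙ y ⁻¹)
      x≈y∙x/y y = sym (trans (comm y _) (//-rightDividesˡ y x))
        where open AbelianGroupProperties A using (//-rightDividesˡ)

    independent-extension : ∀ {I₁ I₂ : Set a} {s : I₁ → Carrier} {t : I₂ → Carrier} →
      (∀ j → t j ∈N) → LC.Independent (π ∘ s) → LB.Independent (f ∘ t) → Independent [ s , t ]
    independent-extension {s = s} {t} t∈N π∘s-independent f∘t-independent =
      Independent-⊎ {b = [ s , t ]} separated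
      where
      separated : ∀ {m₁ m₂} l₁ c₁ l₂ c₂ → InjectiveFin l₁ → InjectiveFin l₂ →
                  combination s m₁ l₁ c₁ ∙ combination t m₂ l₂ c₂ ≈ ε →
                  (∀ k → c₁ k ≡ 0ℤ) × (∀ k → c₂ k ≡ 0ℤ)
      separated {m₁} {m₂} l₁ c₁ l₂ c₂ l₁-injective l₂-injective y₁y₂≈ε = c₁≡0 , c₂≡0
        where
        y₁ y₂ : Carrier
        y₁ = combination s m₁ l₁ c₁
        y₂ = combination t m₂ l₂ c₂
        y₂∈N : y₂ ∈N
        y₂∈N = combination∈ N t∈N m₂ l₂ c₂
        πy₁≈ε : π y₁ C.≈ C.ε
        πy₁≈ε = begin
          π y₁              ≈⟨ C.identityʳ _ ⟨
          π y₁ C.∙ C.ε      ≈⟨ C.∙-congˡ (N⊆ker y₂∈N) ⟨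
          π y₁ C.∙ π y₂     ≈⟨ π.homo _ _ ⟨
          π (y₁ ∙ y₂)       ≈⟨ π.cong _ y₁y₂≈ε ⟩
          π ε               ≈⟨ πP.ε-homo ⟩
          C.ε               ∎
          where open SetoidReasoning C.setoid
        c₁≡0 : ∀ k → c₁ k ≡ 0ℤ
        c₁≡0 = π∘s-independent m₁ l₁ c₁ l₁-injective
                 (C.trans (C.sym (πP.combination-homo {b = s} _ m₁ l₁ c₁)) πy₁≈ε)
        y₂≈ε : y₂ ≈ ε
        y₂≈ε = begin
          y₂          ≈⟨ identityˡ y₂ ⟨
          ε ∙ y₂      ≈⟨ ∙-congʳ (combination-zero s m₁ l₁ c₁≡0) ⟨
          y₁ ∙ y₂     ≈⟨ y₁y₂≈ε ⟩
          ε           ∎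
          where open SetoidReasoning setoid
        c₂≡0 : ∀ k → c₂ k ≡ 0ℤ
        c₂≡0 = f∘t-independent m₂ l₂ c₂ l₂-injective
                 (B.trans (B.sym (fP.combination-homo t∈N m₂ l₂ c₂))
                          (B.trans (f.cong y₂∈N y₂≈ε) fP.ε-homo))

    module _ (S : Subgroup ℓ) where
      open Subgroup S using () renaming (_∈ to _∈S)
      module πS = Image em S (πP.restrict {V = S} (λ _ → _))
      module fS = Image em (S ∩ N) (fP.restrict {V = S ∩ N} proj₂)

      free-extension : GroupNotions.Free C πS.image → GroupNotions.Free B fS.image → Free S
      free-extension (I₁ , b₁ , b₁∈ , b₁-spans , b₁-independent)
                     (I₂ , b₂ , b₂∈ , b₂-spans , b₂-independent) =
        (I₁ ⊎ I₂) , [ s , t ] , [ s∈S , t∈S ] ,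
        (λ _ → spans-extension {S} s∈S t∈N π-spans f-spans) ,
        independent-extension t∈N (LC.Independent-cong b₁≈πs b₁-independent)
                                  (LB.Independent-cong b₂≈ft b₂-independent)
        where
        s : I₁ → Carrier
        s = proj₁ ∘ πS.image-elim ∘ b₁∈
        s∈S : ∀ i → s i ∈S
        s∈S = proj₁ ∘ proj₂ ∘ πS.image-elim ∘ b₁∈
        b₁≈πs : ∀ i → b₁ i C.≈ π (s i)
        b₁≈πs = proj₂ ∘ proj₂ ∘ πS.image-elim ∘ b₁∈
        t : I₂ → Carrier
        t = proj₁ ∘ fS.image-elim ∘ b₂∈
        t∈S : ∀ j → t j ∈S
        t∈S = proj₁ ∘ proj₁ ∘ proj₂ ∘ fS.image-elim ∘ b₂∈
        t∈N : ∀ j → t j ∈N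
        t∈N = proj₂ ∘ proj₁ ∘ proj₂ ∘ fS.image-elim ∘ b₂∈
        b₂≈ft : ∀ j → b₂ j B.≈ f (t j)
        b₂≈ft = proj₂ ∘ proj₂ ∘ fS.image-elim ∘ b₂∈
        π-spans : ∀ {x} → x ∈S → π x LC.∈Span (π ∘ s)
        π-spans x∈S = LC.∈Span-cong b₁≈πs (b₁-spans _ (πS.image-intro x∈S))
        f-spans : ∀ {x} → x ∈S → x ∈N → f x LB.∈Span (f ∘ t)
        f-spans x∈S x∈N = LB.∈Span-cong b₂≈ft (b₂-spans _ (fS.image-intro (x∈S , x∈N)))

    ℵ₁-free-extension : GroupNotions.ℵ₁-Free C → GroupNotions.ℵ₁-Free B → ℵ₁-Free
    ℵ₁-free-extension C-free B-free S S-countable = free-extension S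
      (C-free (πS.image S) (πS.image-countable S S-countable))
      (B-free (fS.image S) (fS.image-countable S (∩-countable S N S-countable _∈N?)))
      where
      _∈N? : ∀ x → Dec (x ∈N)
      x ∈N? = excludedMiddle-lower {ℓ} {a} em

trivial-ℵ₁-free : ∀ {a ℓ} (A : AbelianGroup a ℓ) → (∀ x → AbelianGroup._≈_ A x (AbelianGroup.ε A)) →
                  GroupNotions.ℵ₁-Free A
trivial-ℵ₁-free A trivial S _ =
  ⊥ , (λ ()) , (λ ()) , (λ x _ → 0 , (λ ()) , (λ ()) , trivial x) , independent
  where
  independent : LinearCombinations.Independent A (λ ())
  independent zero    idx coef _ _ ()
  independent (suc n) idx coef _ _ _ with idx zero
  ... | ()

module Quotients {c ℓ} (G : AbelianGroup c ℓ) where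
  open AbelianGroup G
  open GroupNotions G
  open LinearCombinations G using (_⊆_)
  open AbelianGroupProperties G using (x≈y⇒x∙y⁻¹≈ε; ε⁻¹≈ε; ⁻¹-anti-homo‿-; //-rightDividesˡ)
  module _ {q} {X : Subgroup q} where
    private
      module G/X = AbelianGroup (G / X)
    open Subgroup X

    ≈⇒≈/ : ∀ {x y} → x ≈ y → x G/X.≈ y
    ≈⇒≈/ x≈y = resp (sym (x≈y⇒x∙y⁻¹≈ε x≈y)) ε∈

    private
      x∙ε⁻¹≈x : ∀ x → x ∙ ε ⁻¹ ≈ x
      x∙ε⁻¹≈x x = trans (∙-congˡ ε⁻¹≈ε) (identityʳ x)

    ≈/ε⇒∈ : ∀ {x} → x G/X.≈ ε → x ∈
    ≈/ε⇒∈ = resp (x∙ε⁻¹≈x _)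

    ∈⇒≈/ε : ∀ {x} → x ∈ → x G/X.≈ ε
    ∈⇒≈/ε = resp (sym (x∙ε⁻¹≈x _))

  module _ {q} (D H : Subgroup q) (D⊆H : D ⊆ H) where
    open Subgroup H

    subgroup/ : GroupNotions.Subgroup (G / D) q
    subgroup/ = record
      { _∈  = _∈
      ; resp = λ {x} {y} x∙y⁻¹∈D x∈ → resp ([x∙y⁻¹]⁻¹∙x≈y x y) (∙∈ (⁻¹∈ (D⊆H x∙y⁻¹∈D)) x∈)
      ; ε∈  = ε∈
      ; ∙∈  = ∙∈
      ; ⁻¹∈ = ⁻¹∈
      }
      where
      [x∙y⁻¹]⁻¹∙x≈y : ∀ x y → (x ∙ y ⁻¹) ⁻¹ ∙ x ≈ y
      [x∙y⁻¹]⁻¹∙x≈y x y = trans (∙-congʳ (⁻¹-anti-homo‿- x y)) (//-rightDividesˡ x y)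

    projection : HomOn (G / D) (G / H) (PartialAutomorphisms.whole (G / D) q) id
    projection = record { cong = λ _ → D⊆H ; homo = λ _ _ → AbelianGroup.refl (G / H) }

module PreimageQuotient {c ℓ p} (G : AbelianGroup c ℓ) (em : ExcludedMiddle (c ⊔ p))
                        (φ : PartialAutomorphisms.PartialAut G p)
                        (E : GroupNotions.Subgroup G p) where
  open AbelianGroup G
  open GroupNotions G
  open PartialAutomorphisms G p
  open Quotients G
  open Subgroup (Dom φ) renaming (_∈ to _∈H)
  open Subgroup E using () renaming (_∈ to _∈E; resp to respE)
  private
    module G/E = AbelianGroup (G / E)
    module G/D = AbelianGroup (G / preimage φ E)

  H/D : GroupNotions.Subgroup (G / preimage φ E) p
  H/D = subgroup/ (preimage φ E) (Dom φ) proj₁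

  fun-// : ∀ {x y} → x ∈H → y ∈H → fun φ (x ∙ y ⁻¹) ≈ fun φ x ∙ fun φ y ⁻¹
  fun-// x∈ y∈ = trans (fun-hom φ x∈ (⁻¹∈ y∈)) (∙-congˡ (Facts.fun-⁻¹ φ y∈))

  fun-homOn : HomOn (G / preimage φ E) (G / E) H/D (fun φ)
  fun-homOn = record
    { cong = λ x∈ x≈y → respE (fun-// x∈ (GroupNotions.Subgroup.resp H/D x≈y x∈)) (proj₂ x≈y)
    ; homo = λ x∈ y∈ → ≈⇒≈/ {X = E} (fun-hom φ x∈ y∈)
    }

  fun-injective : ∀ {x y} → x ∈H → y ∈H → fun φ x G/E.≈ fun φ y → x G/D.≈ y
  fun-injective x∈ y∈ fx≈fy = ∙∈ x∈ (⁻¹∈ y∈) , respE (sym (fun-// x∈ y∈)) fx≈fy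

  preimage-ℵ₁-free : GroupNotions.ℵ₁-Free (G / Dom φ) → GroupNotions.ℵ₁-Free (G / E) →
                     GroupNotions.ℵ₁-Free (G / preimage φ E)
  preimage-ℵ₁-free = Extension.ℵ₁-free-extension em H/D (projection (preimage φ E) (Dom φ) proj₁)
                       (∈⇒≈/ε {X = Dom φ}) (≈/ε⇒∈ {X = Dom φ}) fun-homOn fun-injective

lemma3p1 : ∀ {c ℓ p} (G : AbelianGroup c ℓ) → ExcludedMiddle (c ⊔ ℓ ⊔ p) →
    let open PartialAutomorphisms G p in
      InPAut idᵖ
      × InPAut negᵖ
      × (∀ φ ψ → InPAut φ → InPAut ψ → InPAut (φ ∘ᵖ ψ))
      × (∀ φ → InPAut φ → InPAut (φ ⁻¹ᵖ))
lemma3p1 {c} {ℓ} {p} G em =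
    (G/whole-ℵ₁-free , G/whole-ℵ₁-free)
  , (G/whole-ℵ₁-free , G/whole-ℵ₁-free)
  -- Im (φ ∘ᵖ ψ) is the preimage of Im φ under ψ ⁻¹ᵖ, whose domain is Im ψ.
  , (λ φ ψ (Dom-φ , Im-φ) (Dom-ψ , Im-ψ) →
       preimage-ℵ₁-free φ (Dom ψ) Dom-φ Dom-ψ , preimage-ℵ₁-free (ψ ⁻¹ᵖ) (Im φ) Im-ψ Im-φ)
  , (λ φ (Dom-φ , Im-φ) → Im-φ , Dom-φ)
  where
  open PartialAutomorphisms G p
  open PreimageQuotient {p = p} G (excludedMiddle-lower {c ⊔ p} {ℓ} em) using (preimage-ℵ₁-free)

  G/whole-ℵ₁-free : GroupNotions.ℵ₁-Free (G / whole)
  G/whole-ℵ₁-free = trivial-ℵ₁-free (G / whole) (λ _ → _)
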